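{- Let $p$ be a prime and $D=\{\mathbf{d}_1,\dots,\mathbf{d}_n\}\subset\mathbb{N}^r\setminus\{0\}$ finite nonempty, $\mathbf{d}_i=(d_{i1},\dots,d_{ir})$, not contained in any coordinate hyperplane $\{x_j=0\}$. Let $T\subset\{1,\dots,r\}$ be nonempty and $D_T=\{\mathbf{d}_i':1\le i\le n\}$ with $\mathbf{d}_i'=(d_{ij})_{j\in T}$. Then $\pi_p(D)\ge\pi_p(D_T)$.
   Context: $\sigma_p(N)$ is the sum of base-$p$ digits of $N\ge0$. For a finite family $D=\{\mathbf{d}_1,\dots,\mathbf{d}_n\}\subset\mathbb{N}^R$ and $m\ge1$, $E_D(m)$ is the set of $U=(u_1,\dots,u_n)\in\{0,\dots,p^m-1\}^n\setminus\{0\}$ with $\sum_iu_i\mathbf{d}_i\equiv0\pmod{p^m-1}$ coordinatewise and $\sum_iu_id_{ij}>0$ for all coordinates $j$; $\sigma_p(D,m)=\min_{U\in E_D(m)}\sum_i\sigma_p(u_i)$, and $\pi_p(D)=\frac{1}{p-1}\min_{m\ge1}\frac{\sigma_p(D,m)}{m}$. -}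

module Defs where

open import Data.Nat using (ℕ; zero; suc; _+_; _*_; _∸_; _^_; _<_; _≤_; NonZero)
open import Relation.Binary.PropositionalEquality using (_≡_; _≢_)
open import Data.Nat.DivMod using (_/_; _%_)
open import Data.Nat.Divisibility using (_∣_)
open import Data.Nat.ListAction using (sum)
open import Data.List using (List)
import Data.List as List
open import Data.Fin using (Fin)
open import Data.Integer using (+_)
open import Data.Rational using (ℚ; 0ℚ) renaming (_/_ to _/ℚ_; _≤_ to _≤ℚ_)
open import Data.Product using (Σ; ∃; _×_)

Σfin : (n : ℕ) → (Fin n → ℕ) → ℕ
Σfin n f = sum (List.tabulate f)

-- σ_p(N): sum of base-p digits of N.  Fuel N is enough since N / p < N for N > 0, p ≥ 2.
digitSumFuel : (p : ℕ) .{{_ : NonZero p}} → ℕ → ℕ → ℕ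
digitSumFuel p zero      N = 0
digitSumFuel p (suc f)   N = N % p + digitSumFuel p f (N / p)

σ : (p : ℕ) .{{_ : NonZero p}} → ℕ → ℕ
σ p N = digitSumFuel p N N

-- A family D = {d_1,…,d_n} ⊂ ℕ^r, d_i = (d_{i1},…,d_{ir}), given as D i j = d_{ij}.
Family : ℕ → ℕ → Set
Family n r = Fin n → Fin r → ℕ

InE : (p : ℕ) {n r : ℕ} → Family n r → ℕ → (Fin n → ℕ) → Set
InE p {n} {r} D m U =
  (∀ i → U i < p ^ m)
  × (Σ (Fin n) λ i → U i ≢ 0)
  × (∀ j → (p ^ m ∸ 1) ∣ Σfin n (λ i → U i * D i j))
  × (∀ j → 0 < Σfin n (λ i → U i * D i j))

cost : (p : ℕ) .{{_ : NonZero p}} {n : ℕ} → (Fin n → ℕ) → ℕ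
cost p {n} U = Σfin n (λ i → σ p (U i))

IsSigmaDM : (p : ℕ) .{{_ : NonZero p}} {n r : ℕ} → Family n r → ℕ → ℕ → Set
IsSigmaDM p {n} D m s =
  (Σ (Fin n → ℕ) λ U → InE p D m U × cost p U ≡ s)
  × (∀ U → InE p D m U → s ≤ cost p U)

-- s / d as a rational number (junk value 0 when d = 0; only used with d = (p−1)m > 0)
ratio : ℕ → ℕ → ℚ
ratio s zero    = 0ℚ
ratio s (suc d) = (+ s) /ℚ (suc d)

IsPi : (p : ℕ) .{{_ : NonZero p}} {n r : ℕ} → Family n r → ℚ → Set
IsPi p D q =
  (Σ ℕ λ m → 1 ≤ m × Σ ℕ λ s → IsSigmaDM p D m s × q ≡ ratio s ((p ∸ 1) * m))
  × (∀ m → 1 ≤ m → ∀ s → IsSigmaDM p D m s → q ≤ℚ ratio s ((p ∸ 1) * m))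

-- D_T: restriction of each d_i to the coordinates in T, T given by an injective τ : Fin t → Fin r
restrict : {n r t : ℕ} → Family n r → (Fin t → Fin r) → Family n t
restrict D τ i k = D i (τ k)

module Submission where

-- Restricting the coordinates can only weaken the conditions
-- defining E_D(m): every congruence and positivity condition imposed by D_T
-- is one of the conditions imposed by D.  Hence E_D(m) ⊆ E_{D_T}(m), so
-- σ_p(D_T,m) ≤ σ_p(D,m) for every m, and π_p(D_T) ≤ π_p(D).
--
-- The theorem applies pi-below-cost for D_T to a witness U attaining π_p(D).

open import Defs
open import Data.Nat using (ℕ; suc; NonZero)
open import Data.Nat.Primality using (Prime)
open import Data.Fin using (Fin)
open import Data.Product using (Σ)
open import Data.Rational using (ℚ; _≤_)
open import Function.Definitions using (Injective)
open import Relation.Binary.PropositionalEquality using (_≡_; _≢_)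

import Data.Nat as ℕ
import Data.Nat.Properties as ℕ
open import Data.Nat.Induction using (<-rec)
open import Data.Product using (_,_; _×_)
open import Relation.Nullary using (¬_; yes; no)
open import Relation.Nullary.Decidable using (decidable-stable; ¬¬-excluded-middle)
open import Relation.Binary.PropositionalEquality using (refl; sym; subst)
import Data.Rational.Properties as ℚ
import Data.Rational.Unnormalised as ℚᵘ
import Data.Rational.Unnormalised.Properties as ℚᵘ
import Data.Integer as ℤ
import Data.Integer.Properties as ℤ

inE-restrict : (p : ℕ) {n r t : ℕ} (D : Family n r) (τ : Fin t → Fin r)
               (m : ℕ) (U : Fin n → ℕ) →
               InE p D m U → InE p (restrict D τ) m U
inE-restrict p D τ m U (bounded , nonzero , divisible , positive) =
  bounded , nonzero , (λ k → divisible (τ k)) , (λ k → positive (τ k))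

Least : {X : Set} → (X → ℕ) → (X → Set) → X → Set
Least {X} w P x = P x × (∀ y → P y → w x ℕ.≤ w y)

-- By strong induction on
-- c: either some witness is strictly lighter (recurse), or x itself is least.
¬¬-least-element : {X : Set} (w : X → ℕ) (P : X → Set) →
                   ∀ c x → P x → w x ≡ c → ¬ ¬ Σ X (Least w P)
¬¬-least-element {X} w P = <-rec Claim step
  where
  Claim : ℕ → Set
  Claim c = ∀ x → P x → w x ≡ c → ¬ ¬ Σ X (Least w P)

  step : ∀ c → (∀ {c′} → c′ ℕ.< c → Claim c′) → Claim c
  step c below x px wx≡c noLeast =
    ¬¬-excluded-middle {A = Σ X λ y → P y × w y ℕ.< c} λ
      { (yes (y , py , wy<c)) → below wy<c y py refl noLeast
      ; (no noneLighter) → noLeast (x , px , λ y py →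
          subst (ℕ._≤ w y) (sym wx≡c)
            (ℕ.≮⇒≥ (λ wy<c → noneLighter (y , py , wy<c)))) }

¬¬-sigma-below : (p : ℕ) .{{_ : NonZero p}} {n r : ℕ} (D : Family n r)
                 (m : ℕ) (U : Fin n → ℕ) → InE p D m U →
                 ¬ ¬ Σ ℕ λ s → IsSigmaDM p D m s × s ℕ.≤ cost p U
¬¬-sigma-below p D m U inU noSigma =
  ¬¬-least-element (cost p) (InE p D m) (cost p U) U inU refl
    λ { (V , inV , minimal) →
          noSigma (cost p V , ((V , inV , refl) , minimal) , minimal U inU) }

ratio-mono : ∀ {s′ s} d → s′ ℕ.≤ s → ratio s′ d ≤ ratio s d
ratio-mono ℕ.zero    _    = ℚ.≤-refl
ratio-mono {s′} {s} (suc d) s′≤s =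
  ℚ.toℚᵘ-cancel-≤
    (ℚᵘ.≤-respʳ-≃ (ℚᵘ.≃-sym (ℚ.toℚᵘ-fromℚᵘ b))
      (ℚᵘ.≤-respˡ-≃ (ℚᵘ.≃-sym (ℚ.toℚᵘ-fromℚᵘ a)) a≤b))
  where
  a b : ℚᵘ.ℚᵘ
  a = ℚᵘ.mkℚᵘ (ℤ.+ s′) d
  b = ℚᵘ.mkℚᵘ (ℤ.+ s) d
  a≤b : a ℚᵘ.≤ b
  a≤b = ℚᵘ.*≤* (ℤ.*-monoʳ-≤-nonNeg (ℤ.+ suc d) (ℤ.+≤+ s′≤s))

-- The double negation from ¬¬-sigma-below is removed by decidability of ≤.
pi-below-cost : (p : ℕ) .{{_ : NonZero p}} {n r : ℕ} (D : Family n r) (q : ℚ) →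
                IsPi p D q → ∀ m → 1 ℕ.≤ m → (U : Fin n → ℕ) → InE p D m U →
                q ≤ ratio (cost p U) ((p ℕ.∸ 1) ℕ.* m)
pi-below-cost p D q (_ , piMinimal) m m≥1 U inU =
  decidable-stable (q ℚ.≤? _) λ notBelow →
    ¬¬-sigma-below p D m U inU λ { (s , isSigma , s≤cost) →
      notBelow (ℚ.≤-trans (piMinimal m m≥1 s isSigma)
                          (ratio-mono ((p ℕ.∸ 1) ℕ.* m) s≤cost)) }

mainTheorem11 : (p : ℕ) .{{_ : NonZero p}} → Prime p →
    (n r : ℕ) → (D : Family (suc n) r) →
    (∀ i → Σ (Fin r) λ j → D i j ≢ 0) →
    (∀ j → Σ (Fin (suc n)) λ i → D i j ≢ 0) →
    (t : ℕ) → (τ : Fin (suc t) → Fin r) → Injective _≡_ _≡_ τ →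
    (q q′ : ℚ) → IsPi p D q → IsPi p (restrict D τ) q′ →
    q′ ≤ q
mainTheorem11 p _ n r D _ _ t τ _ q q′
              ((m , m≥1 , s , ((U , inU , cost≡s) , _) , q≡) , _) piT =
  -- U attains π_p(D) at level m, and U ∈ E_{D_T}(m)
  subst (q′ ≤_) (sym q≡)
    (subst (λ c → q′ ≤ ratio c ((p ℕ.∸ 1) ℕ.* m)) cost≡s
      (pi-below-cost p (restrict D τ) q′ piT m m≥1 U
        (inE-restrict p D τ m U inU)))
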